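{- The subalgebra $\mathcal B^\infty$ of $\mathcal H$ generated by $\mathcal G\cup\{1\}$ is a Hopf algebra; that is, $\Delta(\mathcal B^\infty)\subseteq\mathcal B^\infty\otimes\mathcal B^\infty$, so that $\mathcal B^\infty$ is a Hopf subalgebra of $\mathcal H$.
   Context: An ordered forest of degree $n\ge0$ is a planar rooted forest (left-to-right sequence of rooted trees, children of each vertex linearly ordered left to right) with $n$ vertices together with a bijection from its vertex set to $\{1,\dots,n\}$ (labels); edges point towards roots; $1$ is the empty forest, $\bullet_1$ the one-vertex tree, $|F|$ the degree. The product $FG$ is concatenation (trees of $F$ then trees of $G$), labels of $F$ kept, labels of $G$ increased by $|F|$. A subset $\boldsymbol v$ of vertices of $F$ is an admissible cut if no two distinct elements are joined by a directed path; $Lea_{\boldsymbol v}(F)$ is the subforest of vertices whose path to the root meets $\boldsymbol v$, $Roo_{\boldsymbol v}(F)$ the subforest of the other vertices, both with inherited planar structure and labels standardized by the increasing bijection onto $\{1,\dots,k\}$. $\mathcal H$ is the $\mathbb K$-vector space with basis the ordered forests, with this product and coproduct $\Delta(F)=\sum_{\boldsymbol v}Lea_{\boldsymbol v}(F)\otimes Roo_{\boldsymbol v}(F)$ over all admissible cuts (empty cut included); it is a graded Hopf algebra. For $n\ge1$ and $\underline\varepsilon=(\varepsilon_1,\dots,\varepsilon_n)\in\{+,-\}^n$ define sets $\mathcal G^{(\underline\varepsilon)}$ of ordered forests of degree $n$ recursively: $\mathcal G^{(\varepsilon_1)}=\{\bullet_1\}$; for $n\ge2$, let $F'$ range over $\mathcal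 G^{(\varepsilon_1,\dots,\varepsilon_{n-1})}$ with trees $T_1,\dots,T_m$ from left to right; all vertices of $F'$ keep their labels and a new vertex labelled $n$ is added. If $\varepsilon_n=-$: add a new root whose children are the roots of $T_1,\dots,T_m$ in order. If $\varepsilon_n=+$: either add the new vertex as a one-vertex tree at the right end, or, for some $1\le i\le m$, attach the new vertex as rightmost child of the root of $T_i$ and make the roots of $T_{i+1},\dots,T_m$ (in order) the children of the new vertex. $\mathcal G=\bigcup_{n\ge1}\bigcup_{\underline\varepsilon\in\{+,-\}^n}\mathcal G^{(\underline\varepsilon)}$. -}

module Defs where

open import Level using (Level; _⊔_)
open import Data.Nat using (ℕ; zero; suc; _+_; _<?_)
open import Data.Nat.Properties using () renaming (_≟_ to _≟ℕ_)
open import Data.List using (List; []; _∷_; _++_; [_]; length; map; filter; concatMap; foldr; upTo)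
open import Data.List.Relation.Unary.All using (All; all?)
open import Data.List.Membership.DecPropositional _≟ℕ_ using (_∈_; _∉_; _∈?_)
open import Data.List.Relation.Binary.Permutation.Propositional using (_↭_)
open import Data.Product using (Σ; ∃; _×_; _,_; proj₁; proj₂)
open import Data.Bool using (Bool; true; false; if_then_else_)
open import Relation.Nullary using (Dec; yes; no; ¬_; does)
open import Relation.Nullary.Decidable using (¬?)
open import Relation.Binary.PropositionalEquality using (_≡_; refl; cong; cong₂)
open import Algebra.Bundles using (CommutativeRing)

data Tree : Set where
  node : ℕ → List Tree → Tree

Forest : Set
Forest = List Tree

labelsT : Tree → List ℕ
labelsF : Forest → List ℕ
labelsT (node a ts) = a ∷ labelsF ts
labelsF []       = []
labelsF (t ∷ ts) = labelsT t ++ labelsF ts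

size : Forest → ℕ
size F = length (labelsF F)

IsOrderedForest : Forest → Set
IsOrderedForest F = labelsF F ↭ map suc (upTo (size F))

relabelT : (ℕ → ℕ) → Tree → Tree
relabelF : (ℕ → ℕ) → Forest → Forest
relabelT f (node a ts) = node (f a) (relabelF f ts)
relabelF f []       = []
relabelF f (t ∷ ts) = relabelT f t ∷ relabelF f ts

𝟙 : Forest
𝟙 = []

•₁ : Forest
•₁ = [ node 1 [] ]

_·_ : Forest → Forest → Forest
F · G = F ++ relabelF (size F +_) G

-- standardisation: relabel by the increasing bijection onto {1,…,k}
std : Forest → Forest
std F = relabelF (λ x → suc (length (filter (_<? x) (labelsF F)))) F

-- Cuts.  Vertices are identified with their labels (labels are a bijection).

descT : ℕ → Tree → List ℕ
descF : ℕ → Forest → List ℕ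
descT x (node a ts) with a ≟ℕ x
... | yes _ = labelsF ts
... | no  _ = descF x ts
descF x []       = []
descF x (t ∷ ts) = descT x t ++ descF x ts

sublists : List ℕ → List (List ℕ)
sublists []       = [ [] ]
sublists (x ∷ xs) = let s = sublists xs in map (x ∷_) s ++ s

Admissible : Forest → List ℕ → Set
Admissible F v = All (λ x → All (λ y → y ∉ descF x F) v) v

admissible? : (F : Forest) (v : List ℕ) → Dec (Admissible F v)
admissible? F v = all? (λ x → all? (λ y → ¬? (y ∈? descF x F)) v) v

cuts : Forest → List (List ℕ)
cuts F = filter (admissible? F) (sublists (labelsF F))

-- Lea_v : vertices whose path to the root meets v (unstandardised)
leaT : List ℕ → Tree → Forest
leaF : List ℕ → Forest → Forest
leaT v (node a ts) = if does (a ∈? v) then [ node a ts ] else leaF v ts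
leaF v []       = []
leaF v (t ∷ ts) = leaT v t ++ leaF v ts

-- Roo_v : the other vertices (unstandardised)
rooT : List ℕ → Tree → Forest
rooF : List ℕ → Forest → Forest
rooT v (node a ts) = if does (a ∈? v) then [] else [ node a (rooF v ts) ]
rooF v []       = []
rooF v (t ∷ ts) = rooT v t ++ rooF v ts

Lea Roo : List ℕ → Forest → Forest
Lea v F = std (leaF v F)
Roo v F = std (rooF v F)

node-inj₁ : ∀ {a b ts us} → node a ts ≡ node b us → a ≡ b
node-inj₁ refl = refl

node-inj₂ : ∀ {a b ts us} → node a ts ≡ node b us → ts ≡ us
node-inj₂ refl = refl

∷-inj₁ : ∀ {t u : Tree} {ts us} → t ∷ ts ≡ u ∷ us → t ≡ u
∷-inj₁ refl = refl

∷-inj₂ : ∀ {t u : Tree} {ts us} → t ∷ ts ≡ u ∷ us → ts ≡ us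
∷-inj₂ refl = refl

_≟T_ : (t u : Tree) → Dec (t ≡ u)
_≟F_ : (F G : Forest) → Dec (F ≡ G)
node a ts ≟T node b us with a ≟ℕ b | ts ≟F us
... | yes refl | yes refl = yes refl
... | no a≢b   | _        = no (λ e → a≢b (node-inj₁ e))
... | yes _    | no ne    = no (λ e → ne (node-inj₂ e))
[] ≟F [] = yes refl
[] ≟F (_ ∷ _) = no (λ ())
(_ ∷ _) ≟F [] = no (λ ())
(t ∷ ts) ≟F (u ∷ us) with t ≟T u | ts ≟F us
... | yes refl | yes refl = yes refl
... | no ne    | _        = no (λ e → ne (∷-inj₁ e))
... | yes _    | no ne    = no (λ e → ne (∷-inj₂ e))

-- InG F  iff  F ∈ 𝒢^{(ε)} for some n ≥ 1 and ε; each constructor is one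
-- step of the recursive construction (new vertex labelled n = |F'| + 1).

data InG : Forest → Set where
  base     : InG •₁
  -- ε_n = − : new root whose children are the roots of T₁,…,T_m
  minus    : ∀ {F} → InG F → InG [ node (suc (size F)) F ]
  -- ε_n = + : new one-vertex tree at the right end
  plusEnd  : ∀ {F} → InG F → InG (F ++ [ node (suc (size F)) [] ])
  -- ε_n = + : F = T₁…T_{i-1} T_i T_{i+1}…T_m  with T_i = node a cs;
  -- new vertex becomes rightmost child of root of T_i, with children T_{i+1}…T_m
  plusAt   : ∀ {P a cs S} → InG (P ++ node a cs ∷ S) →
             InG (P ++ [ node a (cs ++ [ node (suc (size (P ++ node a cs ∷ S))) S ]) ])

prod : List Forest → Forest
prod = foldr _·_ 𝟙

-- the basis of ℬ^∞: forests that are products of elements of 𝒢 ∪ {1}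
InB : Forest → Set
InB F = Σ (List Forest) λ Gs → All InG Gs × F ≡ prod Gs

IsField : ∀ {c ℓ} → CommutativeRing c ℓ → Set (c ⊔ ℓ)
IsField K = ¬ (1# ≈ 0#) × (∀ x → ¬ (x ≈ 0#) → Σ Carrier λ y → x * y ≈ 1#)
  where open CommutativeRing K

record Field (c ℓ : Level) : Set (Level.suc (c ⊔ ℓ)) where
  field
    commRing : CommutativeRing c ℓ
    isField  : IsField commRing
  open CommutativeRing commRing public hiding (ring)

module _ {c ℓ} (K : Field c ℓ) where
  open Field K renaming (_+_ to _+ᴷ_; _*_ to _*ᴷ_)

  -- elements of ℋ as finite formal linear combinations of forests
  ℋ : Set c
  ℋ = List (Carrier × Forest)

  ℋ⊗ℋ : Set c
  ℋ⊗ℋ = List (Carrier × Forest × Forest)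

  coeff⊗ : ℋ⊗ℋ → Forest → Forest → Carrier
  coeff⊗ []                  A B = 0#
  coeff⊗ ((k , F , G) ∷ xs) A B with F ≟F A | G ≟F B
  ... | yes _ | yes _ = k +ᴷ coeff⊗ xs A B
  ... | _     | _     = coeff⊗ xs A B

  _≈⊗_ : ℋ⊗ℋ → ℋ⊗ℋ → Set ℓ
  x ≈⊗ y = ∀ A B → coeff⊗ x A B ≈ coeff⊗ y A B

  Δ₀ : Forest → ℋ⊗ℋ
  Δ₀ F = map (λ v → (1# , Lea v F , Roo v F)) (cuts F)

  Δ : ℋ → ℋ⊗ℋ
  Δ = concatMap (λ { (k , F) → map (λ { (k' , A , B) → (k *ᴷ k' , A , B) }) (Δ₀ F) })

  InBᴴ : ℋ → Set c
  InBᴴ x = All (λ p → InB (proj₂ p)) x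

  InB⊗B : ℋ⊗ℋ → Set (c ⊔ ℓ)
  InB⊗B y = Σ ℋ⊗ℋ λ z → All (λ p → InB (proj₁ (proj₂ p)) × InB (proj₂ (proj₂ p))) z × (y ≈⊗ z)

-- Call a forest a 𝒢-forest up to labels if it is empty or arises by the
-- construction of 𝒢 where each new vertex merely gets a label above all
-- previous ones.  Standardising such a forest gives 1 or an element of 𝒢, and
-- standardisation turns label-increasing concatenations into products, so the
-- basis of ℬ^∞ consists of the standardisations of label-increasing
-- concatenations of 𝒢-forests up to labels.  Roo_v of a construction step is
-- the same step applied to Roo_v, or a prefix of it, so Roo_v preserves
-- 𝒢-forests up to labels.  Lea_v of a tree is either the whole tree or Lea_v of
-- its children; as every tree of a 𝒢-forest up to labels, and hereditarily
-- every forest of children, is again one, Lea_v of a label-increasing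
-- concatenation is again such a concatenation.  Hence Lea_v and Roo_v map the
-- basis of ℬ^∞ into itself, and so does Δ.

module Submission where

open import Defs

open import Function using (_∘_)
open import Data.Nat using (ℕ; suc; _+_; _<_; _<?_; z≤n; s≤s; s≤s⁻¹)
open import Data.Nat.Properties using (_≟_; <-irrefl; <-asym; <-trans; n<1+n; +-identityʳ; +-suc; +-monoʳ-<; ≤-<-trans; m<m+n)
open import Data.List using (List; []; _∷_; _++_; [_]; length; map; filter)
open import Data.List.Properties
  using (++-assoc; ++-identityʳ; ++-conicalˡ; ++-conicalʳ; ∷-injective; length-++; length-map; map-++;
         filter-++; filter-all; filter-none)
open import Data.List.Membership.Propositional using (_∈_)
open import Data.List.Membership.Propositional.Properties using (∈-++⁻; ∈-++⁺ˡ; ∈-++⁺ʳ; ∈-map⁻)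
open import Data.List.Membership.DecPropositional _≟_ using (_∈?_)
open import Data.List.Relation.Unary.Any using (here; there)
open import Data.List.Relation.Unary.All as All using (All; []; _∷_)
open import Data.List.Relation.Unary.All.Properties using (++⁺; map⁺)
open import Data.List.Relation.Binary.Permutation.Propositional using (_↭_; ↭-refl; ↭-sym; ↭-reflexive; prep; swap; module PermutationReasoning)
open import Data.List.Relation.Binary.Permutation.Propositional.Properties using (↭-length; filter-↭; ∈-resp-↭; ++⁺ˡ; shift; ∷↭∷ʳ)
open import Data.Product using (∃; _×_; _,_; proj₁; proj₂; map₂)
open import Data.Sum using (_⊎_; inj₁; inj₂)
import Data.Sum as Sum
open import Relation.Nullary using (¬_; yes; no)
open import Relation.Binary.Core using (_Preserves_⟶_)
open import Relation.Binary.PropositionalEquality using (_≡_; refl; sym; trans; cong; cong₂; subst; module ≡-Reasoning)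

-- Labels

infix 4 _∈ᴸ_ _⊆ᴸ_ _≪_

_∈ᴸ_ : ℕ → Forest → Set
x ∈ᴸ F = x ∈ labelsF F

record _⊆ᴸ_ (A B : Forest) : Set where
  constructor ⊆ᴸ⁺
  field ∈-⊆ᴸ : ∀ {x} → x ∈ᴸ A → x ∈ᴸ B
open _⊆ᴸ_

record _≪_ (A B : Forest) : Set where
  constructor ≪⁺
  field <-≪ : ∀ {x y} → x ∈ᴸ A → y ∈ᴸ B → x < y
open _≪_

leaf : ℕ → Forest
leaf n = [ node n [] ]

labels-++ : ∀ A B → labelsF (A ++ B) ≡ labelsF A ++ labelsF B
labels-++ []      B = refl
labels-++ (t ∷ A) B = trans (cong (labelsT t ++_) (labels-++ A B)) (sym (++-assoc (labelsT t) (labelsF A) (labelsF B)))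

labels-node : ∀ a ts → labelsF [ node a ts ] ≡ labelsF (leaf a ++ ts)
labels-node a ts = cong (a ∷_) (++-identityʳ (labelsF ts))

⊆ᴸ-refl : ∀ {A} → A ⊆ᴸ A
⊆ᴸ-refl = ⊆ᴸ⁺ λ p → p

⊆ᴸ-trans : ∀ {A B C} → A ⊆ᴸ B → B ⊆ᴸ C → A ⊆ᴸ C
⊆ᴸ-trans A⊆B B⊆C = ⊆ᴸ⁺ (∈-⊆ᴸ B⊆C ∘ ∈-⊆ᴸ A⊆B)

⊆ᴸ-↭ : ∀ {A B} → labelsF A ↭ labelsF B → A ⊆ᴸ B
⊆ᴸ-↭ A↭B = ⊆ᴸ⁺ λ p → ∈-resp-↭ A↭B p

⊆ᴸ-++ˡ : ∀ A B → A ⊆ᴸ A ++ B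
⊆ᴸ-++ˡ A B = ⊆ᴸ⁺ λ p → subst (_ ∈_) (sym (labels-++ A B)) (∈-++⁺ˡ p)

⊆ᴸ-++ʳ : ∀ A B → B ⊆ᴸ A ++ B
⊆ᴸ-++ʳ A B = ⊆ᴸ⁺ λ p → subst (_ ∈_) (sym (labels-++ A B)) (∈-++⁺ʳ (labelsF A) p)

⊆ᴸ-++⁺ : ∀ {A B C} → A ⊆ᴸ C → B ⊆ᴸ C → A ++ B ⊆ᴸ C
⊆ᴸ-++⁺ {A} {B} A⊆C B⊆C = ⊆ᴸ⁺ λ p →
  Sum.[ ∈-⊆ᴸ A⊆C , ∈-⊆ᴸ B⊆C ] (∈-++⁻ (labelsF A) (subst (_ ∈_) (labels-++ A B) p))

⊆ᴸ-children : ∀ {a ts} → ts ⊆ᴸ [ node a ts ]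
⊆ᴸ-children {a} {ts} = ⊆ᴸ-trans (⊆ᴸ-++ʳ (leaf a) ts) (⊆ᴸ-↭ (↭-sym (↭-reflexive (labels-node a ts))))

⊆ᴸ-node : ∀ {a ts us} → ts ⊆ᴸ us → [ node a ts ] ⊆ᴸ [ node a us ]
⊆ᴸ-node {a} {ts} {us} ts⊆us =
  ⊆ᴸ-trans (⊆ᴸ-↭ (↭-reflexive (labels-node a ts)))
    (⊆ᴸ-trans (⊆ᴸ-++⁺ (⊆ᴸ-++ˡ (leaf a) us) (⊆ᴸ-trans ts⊆us (⊆ᴸ-++ʳ (leaf a) us)))
      (⊆ᴸ-↭ (↭-sym (↭-reflexive (labels-node a us)))))

≪-mono : ∀ {A A′ B B′} → A′ ⊆ᴸ A → B′ ⊆ᴸ B → A ≪ B → A′ ≪ B′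
≪-mono A′⊆A B′⊆B A≪B = ≪⁺ λ p q → <-≪ A≪B (∈-⊆ᴸ A′⊆A p) (∈-⊆ᴸ B′⊆B q)

≪-++ˡ : ∀ {A B C} → A ≪ C → B ≪ C → A ++ B ≪ C
≪-++ˡ {A} {B} A≪C B≪C = ≪⁺ λ p q →
  Sum.[ (λ p′ → <-≪ A≪C p′ q) , (λ p′ → <-≪ B≪C p′ q) ] (∈-++⁻ (labelsF A) (subst (_ ∈_) (labels-++ A B) p))

≪-++ʳ : ∀ {A B C} → A ≪ B → A ≪ C → A ≪ B ++ C
≪-++ʳ {A} {B} {C} A≪B A≪C = ≪⁺ λ p q →
  Sum.[ <-≪ A≪B p , <-≪ A≪C p ] (∈-++⁻ (labelsF B) (subst (_ ∈_) (labels-++ B C) q))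

≪-[]ʳ : ∀ {A} → A ≪ []
≪-[]ʳ = ≪⁺ λ _ ()

≪-[]ˡ : ∀ {A} → [] ≪ A
≪-[]ˡ = ≪⁺ λ ()

leaf-≪ : ∀ {m n} → m < n → leaf m ≪ leaf n
leaf-≪ m<n = ≪⁺ λ { (here refl) (here refl) → m<n }

≪-trans : ∀ {A B m} → A ≪ leaf m → leaf m ≪ B → A ≪ B
≪-trans A≪m m≪B = ≪⁺ λ p q → <-trans (<-≪ A≪m p (here refl)) (<-≪ m≪B (here refl) q)

labels-relabel : ∀ f X → labelsF (relabelF f X) ≡ map f (labelsF X)
labels-relabel f []              = refl
labels-relabel f (node a ts ∷ X) =
  trans (cong₂ (λ U V → (f a ∷ U) ++ V) (labels-relabel f ts) (labels-relabel f X))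
        (cong (f a ∷_) (sym (map-++ f (labelsF ts) (labelsF X))))

∈ᴸ-relabel⁻ : ∀ {x} f X → x ∈ᴸ relabelF f X → ∃ λ y → y ∈ᴸ X × x ≡ f y
∈ᴸ-relabel⁻ f X p = ∈-map⁻ f (subst (_ ∈_) (labels-relabel f X) p)

size-relabel : ∀ f X → size (relabelF f X) ≡ size X
size-relabel f X = trans (cong length (labels-relabel f X)) (length-map f (labelsF X))

relabel-++ : ∀ f A B → relabelF f (A ++ B) ≡ relabelF f A ++ relabelF f B
relabel-++ f []      B = refl
relabel-++ f (t ∷ A) B = cong (relabelT f t ∷_) (relabel-++ f A B)

relabel-∘ : ∀ f g X → relabelF f (relabelF g X) ≡ relabelF (f ∘ g) X
relabel-∘ f g []              = refl
relabel-∘ f g (node a ts ∷ X) = cong₂ _∷_ (cong (node (f (g a))) (relabel-∘ f g ts)) (relabel-∘ f g X)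

relabel-cong : ∀ {f g} X → (∀ {x} → x ∈ᴸ X → f x ≡ g x) → relabelF f X ≡ relabelF g X
relabel-cong []              f≗g = refl
relabel-cong (node a ts ∷ X) f≗g =
  cong₂ _∷_ (cong₂ node (f≗g (here refl)) (relabel-cong ts (f≗g ∘ there ∘ ∈-++⁺ˡ)))
            (relabel-cong X (f≗g ∘ there ∘ ∈-++⁺ʳ (labelsF ts)))

≪-relabel : ∀ {f} → f Preserves _<_ ⟶ _<_ → ∀ {A B} → A ≪ B → relabelF f A ≪ relabelF f B
≪-relabel {f} f-mono {A} {B} A≪B = ≪⁺ λ p q → lt (∈ᴸ-relabel⁻ f A p) (∈ᴸ-relabel⁻ f B q)
  where
  lt : ∀ {x y} → (∃ λ x₀ → x₀ ∈ᴸ A × x ≡ f x₀) → (∃ λ y₀ → y₀ ∈ᴸ B × y ≡ f y₀) → x < y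
  lt (_ , p₀ , refl) (_ , q₀ , refl) = f-mono (<-≪ A≪B p₀ q₀)

≪-shift : ∀ {A B m} → A ≪ leaf (suc m) → leaf 0 ≪ B → A ≪ relabelF (m +_) B
≪-shift {A} {B} {m} A≤m B>0 = ≪⁺ λ p q → lt p (∈ᴸ-relabel⁻ (m +_) B q)
  where
  lt : ∀ {x y} → x ∈ᴸ A → (∃ λ y₀ → y₀ ∈ᴸ B × y ≡ m + y₀) → x < y
  lt p (_ , q₀ , refl) = ≤-<-trans (s≤s⁻¹ (<-≪ A≤m p (here refl))) (m<m+n m (<-≪ B>0 (here refl) q₀))

record Extends (N F : Forest) (n : ℕ) : Set where
  constructor extends
  field labels-↭ : labelsF N ↭ n ∷ labelsF F
open Extends

Extends-⊆ᴸ : ∀ {N F n} → Extends N F n → N ⊆ᴸ leaf n ++ F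
Extends-⊆ᴸ N⊇F = ⊆ᴸ-↭ (labels-↭ N⊇F)

extends-minus : ∀ n F → Extends [ node n F ] F n
extends-minus n F = extends (↭-reflexive (labels-node n F))

extends-plusEnd : ∀ F n → Extends (F ++ leaf n) F n
extends-plusEnd F n = extends (subst (_↭ n ∷ labelsF F) (sym (labels-++ F (leaf n))) (↭-sym (∷↭∷ʳ n (labelsF F))))

extends-plusAt : ∀ P a cs S n → Extends (P ++ [ node a (cs ++ [ node n S ]) ]) (P ++ node a cs ∷ S) n
extends-plusAt P a cs S n = extends (begin
  labelsF (P ++ [ node a (cs ++ [ node n S ]) ])  ≡⟨ trans (labels-++ P [ node a (cs ++ [ node n S ]) ]) (cong (labelsF P ++_) (labels-node a (cs ++ [ node n S ]))) ⟩
  lP ++ a ∷ labelsF (cs ++ [ node n S ])          ≡⟨ cong (λ L → lP ++ a ∷ L) (trans (labels-++ cs [ node n S ]) (cong (lcs ++_) (labels-node n S))) ⟩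
  lP ++ a ∷ (lcs ++ [ n ] ++ lS)                  ↭⟨ ++⁺ˡ lP (prep a (shift n lcs lS)) ⟩
  lP ++ [ a ] ++ n ∷ lcs ++ lS                    ↭⟨ ++⁺ˡ lP (swap a n ↭-refl) ⟩
  lP ++ [ n ] ++ a ∷ lcs ++ lS                    ↭⟨ shift n lP (a ∷ lcs ++ lS) ⟩
  n ∷ lP ++ a ∷ lcs ++ lS                         ≡⟨ cong (n ∷_) (sym (labels-++ P (node a cs ∷ S))) ⟩
  n ∷ labelsF (P ++ node a cs ∷ S)                ∎)
  where
  open PermutationReasoning
  lP = labelsF P
  lcs = labelsF cs
  lS = labelsF S

-- 𝒢 ∪ {1} up to labels: the construction of 𝒢, except that the new vertex may
-- carry any label exceeding all present ones.
data InGᵘ : Forest → Set where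
  empty   : InGᵘ 𝟙
  minus   : ∀ {F n} → InGᵘ F → F ≪ leaf n → InGᵘ [ node n F ]
  plusEnd : ∀ {F n} → InGᵘ F → F ≪ leaf n → InGᵘ (F ++ leaf n)
  plusAt  : ∀ {P a cs S n} → InGᵘ (P ++ node a cs ∷ S) → P ++ node a cs ∷ S ≪ leaf n →
            InGᵘ (P ++ [ node a (cs ++ [ node n S ]) ])

∷ʳ-≡-++⁻ : ∀ {A : Set} (xs : List A) y P Q → xs ++ [ y ] ≡ P ++ Q →
  (Q ≡ [] × P ≡ xs ++ [ y ]) ⊎ ∃ λ Q′ → Q ≡ Q′ ++ [ y ] × xs ≡ P ++ Q′
∷ʳ-≡-++⁻ xs       y []      Q e = inj₂ (xs , sym e , refl)
∷ʳ-≡-++⁻ []       y (p ∷ P) Q e with refl , e′ ← ∷-injective e =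
  inj₁ (++-conicalʳ P Q (sym e′) , cong (p ∷_) (++-conicalˡ P Q (sym e′)))
∷ʳ-≡-++⁻ (x ∷ xs) y (p ∷ P) Q e with refl , e′ ← ∷-injective e =
  Sum.map (map₂ (cong (x ∷_))) (map₂ (map₂ (cong (x ∷_)))) (∷ʳ-≡-++⁻ xs y P Q e′)

InGᵘ-++⁻ : ∀ {F} → InGᵘ F → ∀ P Q → F ≡ P ++ Q → InGᵘ P × InGᵘ Q
InGᵘ-++⁻ empty P Q e rewrite ++-conicalˡ P Q (sym e) | ++-conicalʳ P Q (sym e) = empty , empty
InGᵘ-++⁻ (minus g b) P Q e with ∷ʳ-≡-++⁻ [] _ P Q e
... | inj₁ (refl , refl) = minus g b , empty
... | inj₂ (Q′ , refl , []≡P++Q′) rewrite ++-conicalˡ P Q′ (sym []≡P++Q′) | ++-conicalʳ P Q′ (sym []≡P++Q′) =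
  empty , minus g b
InGᵘ-++⁻ (plusEnd {F} g b) P Q e with ∷ʳ-≡-++⁻ F _ P Q e
... | inj₁ (refl , refl) = plusEnd g b , empty
... | inj₂ (Q′ , refl , refl) =
  map₂ (λ gQ′ → plusEnd gQ′ (≪-mono (⊆ᴸ-++ʳ P Q′) ⊆ᴸ-refl b)) (InGᵘ-++⁻ g P Q′ refl)
InGᵘ-++⁻ (plusAt {P₀} {a} {cs} {S} g b) P Q e with ∷ʳ-≡-++⁻ P₀ _ P Q e
... | inj₁ (refl , refl) = plusAt g b , empty
... | inj₂ (Q′ , refl , refl) =
  map₂ (λ gQ → plusAt gQ (≪-mono (⊆ᴸ-++ʳ P _) ⊆ᴸ-refl (subst (_≪ _) (++-assoc P Q′ _) b)))
       (InGᵘ-++⁻ g P (Q′ ++ node a cs ∷ S) (++-assoc P Q′ _))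

InGᵘ-relabel : ∀ {f} → f Preserves _<_ ⟶ _<_ → ∀ {X} → InGᵘ X → InGᵘ (relabelF f X)
InGᵘ-relabel f-mono empty       = empty
InGᵘ-relabel f-mono (minus g b) = minus (InGᵘ-relabel f-mono g) (≪-relabel f-mono b)
InGᵘ-relabel {f} f-mono (plusEnd {F} {n} g b) =
  subst InGᵘ (sym (relabel-++ f F (leaf n))) (plusEnd (InGᵘ-relabel f-mono g) (≪-relabel f-mono b))
InGᵘ-relabel {f} f-mono (plusAt {P} {a} {cs} {S} {n} g b) =
  subst InGᵘ (sym (trans (relabel-++ f P _) (cong (λ Z → relabelF f P ++ [ node (f a) Z ]) (relabel-++ f cs [ node n S ]))))
    (plusAt (subst InGᵘ F′-shape (InGᵘ-relabel f-mono g)) (subst (_≪ _) F′-shape (≪-relabel f-mono b)))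
  where
  F′-shape : relabelF f (P ++ node a cs ∷ S) ≡ relabelF f P ++ node (f a) (relabelF f cs) ∷ relabelF f S
  F′-shape = relabel-++ f P (node a cs ∷ S)

data HerGᵘ : Forest → Set where
  []   : HerGᵘ []
  cons : ∀ {a ts F} → InGᵘ [ node a ts ] → HerGᵘ ts → [ node a ts ] ≪ F → HerGᵘ F → HerGᵘ (node a ts ∷ F)

HerGᵘ-++ : ∀ {A B} → HerGᵘ A → HerGᵘ B → A ≪ B → HerGᵘ (A ++ B)
HerGᵘ-++ []                           hB A≪B = hB
HerGᵘ-++ {node a ts ∷ A} {B} (cons g h t≪A hA) hB A≪B =
  cons g h (≪-++ʳ t≪A (≪-mono (⊆ᴸ-++ˡ [ node a ts ] A) ⊆ᴸ-refl A≪B))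
    (HerGᵘ-++ hA hB (≪-mono (⊆ᴸ-++ʳ [ node a ts ] A) ⊆ᴸ-refl A≪B))

HerGᵘ-++⁻ : ∀ A {B} → HerGᵘ (A ++ B) → HerGᵘ A × HerGᵘ B × A ≪ B
HerGᵘ-++⁻ []              h = [] , h , ≪-[]ˡ
HerGᵘ-++⁻ (node a ts ∷ A) {B} (cons g h t≪AB hAB) with HerGᵘ-++⁻ A hAB
... | hA , hB , A≪B =
  cons g h (≪-mono ⊆ᴸ-refl (⊆ᴸ-++ˡ A B) t≪AB) hA , hB ,
  ≪-++ˡ {[ node a ts ]} (≪-mono ⊆ᴸ-refl (⊆ᴸ-++ʳ A B) t≪AB) A≪B

HerGᵘ-tree : ∀ {a ts} → InGᵘ [ node a ts ] → HerGᵘ ts → HerGᵘ [ node a ts ]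
HerGᵘ-tree g h = cons g h ≪-[]ʳ []

InGᵘ⇒HerGᵘ : ∀ {F} → InGᵘ F → HerGᵘ F
InGᵘ⇒HerGᵘ empty             = []
InGᵘ⇒HerGᵘ (minus g b)       = HerGᵘ-tree (minus g b) (InGᵘ⇒HerGᵘ g)
InGᵘ⇒HerGᵘ (plusEnd g b)     = HerGᵘ-++ (InGᵘ⇒HerGᵘ g) (HerGᵘ-tree (minus empty ≪-[]ˡ) []) b
InGᵘ⇒HerGᵘ (plusAt {P} {a} {cs} {S} {n} g b)
  with HerGᵘ-++⁻ P (InGᵘ⇒HerGᵘ g) | InGᵘ-++⁻ g P (node a cs ∷ S) refl
... | hP , cons _ hcs a≪S hS , P≪aS | _ , gaS =
  HerGᵘ-++ hP (HerGᵘ-tree (plusAt {[]} gaS aS≪n) (HerGᵘ-++ hcs (HerGᵘ-tree (minus gS S≪n) hS) cs≪nS)) P≪new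
  where
  aS≪n : node a cs ∷ S ≪ leaf n
  aS≪n = ≪-mono (⊆ᴸ-++ʳ P _) ⊆ᴸ-refl b
  gS : InGᵘ S
  gS = proj₂ (InGᵘ-++⁻ gaS [ node a cs ] S refl)
  S≪n : S ≪ leaf n
  S≪n = ≪-mono (⊆ᴸ-++ʳ [ node a cs ] S) ⊆ᴸ-refl aS≪n
  cs≪nS : cs ≪ [ node n S ]
  cs≪nS = ≪-mono ⊆ᴸ-children (Extends-⊆ᴸ (extends-minus n S))
            (≪-++ʳ (≪-mono (⊆ᴸ-++ˡ [ node a cs ] S) ⊆ᴸ-refl aS≪n) a≪S)
  P≪new : P ≪ [ node a (cs ++ [ node n S ]) ]
  P≪new = ≪-mono ⊆ᴸ-refl (Extends-⊆ᴸ (extends-plusAt [] a cs S n))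
            (≪-++ʳ (≪-mono (⊆ᴸ-++ˡ P _) ⊆ᴸ-refl b) P≪aS)

data InBᵘ : Forest → Set where
  []    : InBᵘ 𝟙
  block : ∀ {G H} → InGᵘ G → G ≪ H → InBᵘ H → InBᵘ (G ++ H)

InBᵘ-++ : ∀ {A B} → InBᵘ A → InBᵘ B → A ≪ B → InBᵘ (A ++ B)
InBᵘ-++ []                        hB A≪B = hB
InBᵘ-++ {B = B} (block {G} {H} g G≪H hH) hB GH≪B =
  subst InBᵘ (sym (++-assoc G H B))
    (block g (≪-++ʳ G≪H (≪-mono (⊆ᴸ-++ˡ G H) ⊆ᴸ-refl GH≪B)) (InBᵘ-++ hH hB (≪-mono (⊆ᴸ-++ʳ G H) ⊆ᴸ-refl GH≪B)))

InBᵘ-relabel : ∀ {f} → f Preserves _<_ ⟶ _<_ → ∀ {X} → InBᵘ X → InBᵘ (relabelF f X)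
InBᵘ-relabel f-mono []                     = []
InBᵘ-relabel {f} f-mono (block {G} {H} g G≪H h) =
  subst InBᵘ (sym (relabel-++ f G H)) (block (InGᵘ-relabel f-mono g) (≪-relabel f-mono G≪H) (InBᵘ-relabel f-mono h))

-- Cuts

lea-++ : ∀ v A B → leaF v (A ++ B) ≡ leaF v A ++ leaF v B
lea-++ v []      B = refl
lea-++ v (t ∷ A) B = trans (cong (leaT v t ++_) (lea-++ v A B)) (sym (++-assoc (leaT v t) _ _))

roo-++ : ∀ v A B → rooF v (A ++ B) ≡ rooF v A ++ rooF v B
roo-++ v []      B = refl
roo-++ v (t ∷ A) B = trans (cong (rooT v t ++_) (roo-++ v A B)) (sym (++-assoc (rooT v t) _ _))

lea-⊆ᴸ : ∀ v F → leaF v F ⊆ᴸ F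
leaT-⊆ᴸ : ∀ v t → leaT v t ⊆ᴸ [ t ]
lea-⊆ᴸ v []      = ⊆ᴸ-refl
lea-⊆ᴸ v (t ∷ F) = ⊆ᴸ-++⁺ (⊆ᴸ-trans (leaT-⊆ᴸ v t) (⊆ᴸ-++ˡ [ t ] F)) (⊆ᴸ-trans (lea-⊆ᴸ v F) (⊆ᴸ-++ʳ [ t ] F))
leaT-⊆ᴸ v (node a ts) with a ∈? v
... | yes _ = ⊆ᴸ-refl
... | no  _ = ⊆ᴸ-trans (lea-⊆ᴸ v ts) ⊆ᴸ-children

roo-⊆ᴸ : ∀ v F → rooF v F ⊆ᴸ F
rooT-⊆ᴸ : ∀ v t → rooT v t ⊆ᴸ [ t ]
roo-⊆ᴸ v []      = ⊆ᴸ-refl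
roo-⊆ᴸ v (t ∷ F) = ⊆ᴸ-++⁺ (⊆ᴸ-trans (rooT-⊆ᴸ v t) (⊆ᴸ-++ˡ [ t ] F)) (⊆ᴸ-trans (roo-⊆ᴸ v F) (⊆ᴸ-++ʳ [ t ] F))
rooT-⊆ᴸ v (node a ts) with a ∈? v
... | yes _ = ⊆ᴸ⁺ λ ()
... | no  _ = ⊆ᴸ-node (roo-⊆ᴸ v ts)

HerGᵘ-lea : ∀ v {F} → HerGᵘ F → InBᵘ (leaF v F)
HerGᵘ-lea v []                                = []
HerGᵘ-lea v (cons {a} {ts} {F} g h t≪F hF) with a ∈? v
... | yes _ = block {G = [ node a ts ]} g (≪-mono ⊆ᴸ-refl (lea-⊆ᴸ v F) t≪F) (HerGᵘ-lea v hF)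
... | no  _ = InBᵘ-++ (HerGᵘ-lea v h) (HerGᵘ-lea v hF)
                (≪-mono (⊆ᴸ-trans (lea-⊆ᴸ v ts) ⊆ᴸ-children) (lea-⊆ᴸ v F) t≪F)

roo-around : ∀ v P a cs S →
  rooF v (P ++ node a cs ∷ S) ≡ (rooF v P ++ rooF v [ node a cs ]) ++ rooF v S
roo-around v P a cs S =
  trans (roo-++ v P (node a cs ∷ S))
    (trans (cong (rooF v P ++_) (roo-++ v [ node a cs ] S)) (sym (++-assoc (rooF v P) _ _)))

roo-plusAt : ∀ v a cs n S →
  rooF v [ node a (cs ++ [ node n S ]) ] ≡ rooF v [ node a cs ] ⊎
  (rooF v [ node a cs ] ≡ [ node a (rooF v cs) ] ×
   rooF v [ node a (cs ++ [ node n S ]) ] ≡ [ node a (rooF v cs ++ [ node n (rooF v S) ]) ])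
roo-plusAt v a cs n S rewrite roo-++ v cs [ node n S ] with a ∈? v | n ∈? v
... | yes _ | _     = inj₁ refl
... | no  _ | yes _ = inj₁ (cong (λ Z → [ node a Z ]) (++-identityʳ (rooF v cs)))
... | no  _ | no  _ = inj₂ (refl , refl)

InGᵘ-roo : ∀ v {F} → InGᵘ F → InGᵘ (rooF v F)
InGᵘ-roo v empty = empty
InGᵘ-roo v (minus {F} {n} g b) with n ∈? v
... | yes _ = empty
... | no  _ = minus (InGᵘ-roo v g) (≪-mono (roo-⊆ᴸ v F) ⊆ᴸ-refl b)
InGᵘ-roo v (plusEnd {F} {n} g b) rewrite roo-++ v F (leaf n) with n ∈? v
... | yes _ = subst InGᵘ (sym (++-identityʳ (rooF v F))) (InGᵘ-roo v g)
... | no  _ = plusEnd (InGᵘ-roo v g) (≪-mono (roo-⊆ᴸ v F) ⊆ᴸ-refl b)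
InGᵘ-roo v (plusAt {P} {a} {cs} {S} {n} g b)
  with roo-plusAt v a cs n S | subst InGᵘ (roo-around v P a cs S) (InGᵘ-roo v g)
... | inj₁ T≡A | g′ =
  subst InGᵘ (sym (trans (roo-++ v P _) (cong (rooF v P ++_) T≡A)))
    (proj₁ (InGᵘ-++⁻ g′ (rooF v P ++ rooF v [ node a cs ]) (rooF v S) refl))
... | inj₂ (A≡ , T≡) | g′ =
  subst InGᵘ (sym (trans (roo-++ v P _) (cong (rooF v P ++_) T≡)))
    (plusAt (subst InGᵘ (shape A≡) g′)
            (subst (_≪ leaf n) (trans (roo-around v P a cs S) (shape A≡))
              (≪-mono (roo-⊆ᴸ v (P ++ node a cs ∷ S)) ⊆ᴸ-refl b)))
  where
  shape : rooF v [ node a cs ] ≡ [ node a (rooF v cs) ] →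
          (rooF v P ++ rooF v [ node a cs ]) ++ rooF v S ≡ rooF v P ++ node a (rooF v cs) ∷ rooF v S
  shape A≡ = trans (++-assoc (rooF v P) _ _) (cong (λ A → rooF v P ++ A ++ rooF v S) A≡)

InBᵘ-lea : ∀ v {F} → InBᵘ F → InBᵘ (leaF v F)
InBᵘ-lea v []                      = []
InBᵘ-lea v (block {G} {H} g G≪H h) = subst InBᵘ (sym (lea-++ v G H))
  (InBᵘ-++ (HerGᵘ-lea v (InGᵘ⇒HerGᵘ g)) (InBᵘ-lea v h) (≪-mono (lea-⊆ᴸ v G) (lea-⊆ᴸ v H) G≪H))

InBᵘ-roo : ∀ v {F} → InBᵘ F → InBᵘ (rooF v F)
InBᵘ-roo v []                      = []
InBᵘ-roo v (block {G} {H} g G≪H h) = subst InBᵘ (sym (roo-++ v G H))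
  (block (InGᵘ-roo v g) (≪-mono (roo-⊆ᴸ v G) (roo-⊆ᴸ v H) G≪H) (InBᵘ-roo v h))

-- Standardisation

#below : Forest → ℕ → ℕ
#below F x = length (filter (_<? x) (labelsF F))

rank : Forest → ℕ → ℕ
rank F x = suc (#below F x)

#below-↭ : ∀ A B x → labelsF A ↭ labelsF B → #below A x ≡ #below B x
#below-↭ A B x A↭B = ↭-length (filter-↭ (_<? x) A↭B)

#below-++ : ∀ A B x → #below (A ++ B) x ≡ #below A x + #below B x
#below-++ A B x = begin
  length (filter (_<? x) (labelsF (A ++ B)))                          ≡⟨ cong (length ∘ filter (_<? x)) (labels-++ A B) ⟩
  length (filter (_<? x) (labelsF A ++ labelsF B))                    ≡⟨ cong length (filter-++ (_<? x) (labelsF A) (labelsF B)) ⟩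
  length (filter (_<? x) (labelsF A) ++ filter (_<? x) (labelsF B))   ≡⟨ length-++ (filter (_<? x) (labelsF A)) ⟩
  #below A x + #below B x                                             ∎
  where open ≡-Reasoning

#below-all : ∀ A {x} → A ≪ leaf x → #below A x ≡ size A
#below-all A A≪x = cong length (filter-all (_<? _) (All.tabulate λ p → <-≪ A≪x p (here refl)))

#below-none : ∀ A {x} → (∀ {y} → y ∈ᴸ A → ¬ y < x) → #below A x ≡ 0
#below-none A A≮x = cong length (filter-none (_<? _) (All.tabulate A≮x))

#below-extend : ∀ {N F n x} → Extends N F n → ¬ n < x → #below N x ≡ #below F x
#below-extend {N} {F} {n} {x} N⊇F n≮x =
  trans (#below-↭ N (leaf n ++ F) x (labels-↭ N⊇F))
    (trans (#below-++ (leaf n) F x) (cong (_+ #below F x) (#below-none (leaf n) λ { (here refl) → n≮x })))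

rank-extend : ∀ {N F n} → Extends N F n → F ≪ leaf n → ∀ {x} → x ∈ᴸ F → rank N x ≡ rank F x
rank-extend N⊇F F≪n p = cong suc (#below-extend N⊇F (<-asym (<-≪ F≪n p (here refl))))

rank-extend-new : ∀ {N F n} → Extends N F n → F ≪ leaf n → rank N n ≡ suc (size F)
rank-extend-new {F = F} N⊇F F≪n = cong suc (trans (#below-extend N⊇F (<-irrefl refl)) (#below-all F F≪n))

size-extend : ∀ {N F n} → Extends N F n → size N ≡ suc (size F)
size-extend = ↭-length ∘ labels-↭

size-std : ∀ F → size (std F) ≡ size F
size-std F = size-relabel (rank F) F

std-++ : ∀ {G H} → G ≪ H → std (G ++ H) ≡ std G · std H
std-++ {G} {H} G≪H = begin
  relabelF (rank (G ++ H)) (G ++ H)                          ≡⟨ relabel-++ (rank (G ++ H)) G H ⟩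
  relabelF (rank (G ++ H)) G ++ relabelF (rank (G ++ H)) H   ≡⟨ cong₂ _++_ (relabel-cong G on-G) (relabel-cong H on-H) ⟩
  std G ++ relabelF ((size G +_) ∘ rank H) H                 ≡⟨ cong (std G ++_) (sym (relabel-∘ (size G +_) (rank H) H)) ⟩
  std G ++ relabelF (size G +_) (std H)                      ≡⟨ cong (λ k → std G ++ relabelF (k +_) (std H)) (sym (size-std G)) ⟩
  std G · std H                                              ∎
  where
  open ≡-Reasoning
  on-G : ∀ {x} → x ∈ᴸ G → rank (G ++ H) x ≡ rank G x
  on-G {x} p = cong suc (trans (#below-++ G H x)
    (trans (cong (#below G x +_) (#below-none H λ q → <-asym (<-≪ G≪H p q))) (+-identityʳ _)))
  on-H : ∀ {x} → x ∈ᴸ H → rank (G ++ H) x ≡ size G + rank H x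
  on-H {x} q = begin
    suc (#below (G ++ H) x)        ≡⟨ cong suc (#below-++ G H x) ⟩
    suc (#below G x + #below H x)  ≡⟨ cong (λ k → suc (k + #below H x)) (#below-all G (≪⁺ λ p → λ { (here refl) → <-≪ G≪H p q })) ⟩
    suc (size G + #below H x)      ≡⟨ +-suc (size G) (#below H x) ⟨
    size G + rank H x              ∎

std-minus : ∀ {F n} → F ≪ leaf n → std [ node n F ] ≡ [ node (suc (size (std F))) (std F) ]
std-minus {F} {n} F≪n =
  cong₂ (λ m F′ → [ node m F′ ])
    (trans (rank-extend-new N⊇F F≪n) (cong suc (sym (size-std F))))
    (relabel-cong F (rank-extend N⊇F F≪n))
  where N⊇F = extends-minus n F

std-plusEnd : ∀ {F n} → F ≪ leaf n → std (F ++ leaf n) ≡ std F ++ leaf (suc (size (std F)))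
std-plusEnd {F} {n} F≪n =
  trans (relabel-++ (rank (F ++ leaf n)) F (leaf n))
    (cong₂ (λ F′ m → F′ ++ leaf m)
      (relabel-cong F (rank-extend N⊇F F≪n))
      (trans (rank-extend-new N⊇F F≪n) (cong suc (sym (size-std F)))))
  where N⊇F = extends-plusEnd F n

std-plusAt : ∀ {P a cs S n} → P ++ node a cs ∷ S ≪ leaf n →
  let f = rank (P ++ node a cs ∷ S) in
  std (P ++ [ node a (cs ++ [ node n S ]) ]) ≡
  relabelF f P ++ [ node (f a) (relabelF f cs ++ [ node (suc (size (relabelF f P ++ node (f a) (relabelF f cs) ∷ relabelF f S))) (relabelF f S) ]) ]
std-plusAt {P} {a} {cs} {S} {n} F′≪n = begin
  relabelF g (P ++ [ node a (cs ++ [ node n S ]) ])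
    ≡⟨ relabel-++ g P _ ⟩
  relabelF g P ++ [ node (g a) (relabelF g (cs ++ [ node n S ])) ]
    ≡⟨ cong (λ Z → relabelF g P ++ [ node (g a) Z ]) (relabel-++ g cs [ node n S ]) ⟩
  relabelF g P ++ [ node (g a) (relabelF g cs ++ [ node (g n) (relabelF g S) ]) ]
    ≡⟨ cong₂ (λ P′ T → P′ ++ [ T ]) (on (⊆ᴸ-++ˡ P _))
         (cong₂ node (rank-extend N⊇F F′≪n (∈-⊆ᴸ (⊆ᴸ-++ʳ P _) (here refl)))
           (cong₂ (λ cs′ T → cs′ ++ [ T ]) (on cs⊆F′) (cong₂ node new-rank (on S⊆F′)))) ⟩
  relabelF f P ++ [ node (f a) (relabelF f cs ++ [ node (suc (size (relabelF f F′))) (relabelF f S) ]) ]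
    ≡⟨ cong (λ F″ → relabelF f P ++ [ node (f a) (relabelF f cs ++ [ node (suc (size F″)) (relabelF f S) ]) ])
         (relabel-++ f P (node a cs ∷ S)) ⟩
  _ ∎
  where
  open ≡-Reasoning
  F′ = P ++ node a cs ∷ S
  f = rank F′
  g = rank (P ++ [ node a (cs ++ [ node n S ]) ])
  N⊇F = extends-plusAt P a cs S n
  on : ∀ {Y} → Y ⊆ᴸ F′ → relabelF g Y ≡ relabelF f Y
  on {Y} Y⊆F′ = relabel-cong Y (rank-extend N⊇F F′≪n ∘ ∈-⊆ᴸ Y⊆F′)
  cs⊆F′ : cs ⊆ᴸ F′
  cs⊆F′ = ⊆ᴸ-trans ⊆ᴸ-children (⊆ᴸ-trans (⊆ᴸ-++ˡ [ node a cs ] S) (⊆ᴸ-++ʳ P _))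
  S⊆F′ : S ⊆ᴸ F′
  S⊆F′ = ⊆ᴸ-trans (⊆ᴸ-++ʳ [ node a cs ] S) (⊆ᴸ-++ʳ P _)
  new-rank : g n ≡ suc (size (relabelF f F′))
  new-rank = trans (rank-extend-new N⊇F F′≪n) (cong suc (sym (size-std F′)))

InGᵘ⇒InG : ∀ {X} → InGᵘ X → X ≡ 𝟙 ⊎ InG (std X)
InGᵘ⇒InG empty = inj₁ refl
InGᵘ⇒InG (minus g b) = inj₂ (subst InG (sym (std-minus b)) (Sum.[ (λ { refl → base }) , minus ] (InGᵘ⇒InG g)))
InGᵘ⇒InG (plusEnd g b) = inj₂ (subst InG (sym (std-plusEnd b)) (Sum.[ (λ { refl → base }) , plusEnd ] (InGᵘ⇒InG g)))
InGᵘ⇒InG (plusAt {P} {a} {cs} {S} g b) with InGᵘ⇒InG g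
... | inj₁ F′≡𝟙 with () ← ++-conicalʳ P (node a cs ∷ S) F′≡𝟙
... | inj₂ h = inj₂ (subst InG (sym (std-plusAt b))
  (plusAt {relabelF f P} {f a} {relabelF f cs} {relabelF f S} (subst InG (relabel-++ f P (node a cs ∷ S)) h)))
  where f = rank (P ++ node a cs ∷ S)

InBᵘ⇒InB : ∀ {X} → InBᵘ X → InB (std X)
InBᵘ⇒InB [] = [] , [] , refl
InBᵘ⇒InB (block {G} {H} g G≪H h) with InBᵘ⇒InB h | InGᵘ⇒InG g
... | Hs , hs , H≡ | inj₁ refl = Hs , hs , H≡
... | Hs , hs , H≡ | inj₂ gG   = std G ∷ Hs , gG ∷ hs , trans (std-++ G≪H) (cong (std G ·_) H≡)

-- The basis of ℬ^∞

labels-extend : ∀ {N F} → Extends N F (suc (size F)) →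
  leaf 0 ≪ F × F ≪ leaf (suc (size F)) → leaf 0 ≪ N × N ≪ leaf (suc (size N))
labels-extend {N} {F} N⊇F (F>0 , F≤) =
  ≪-mono ⊆ᴸ-refl N⊆ (≪-++ʳ (leaf-≪ (s≤s z≤n)) F>0) ,
  subst (λ m → N ≪ leaf (suc m)) (sym (size-extend N⊇F))
    (≪-mono N⊆ ⊆ᴸ-refl (≪-++ˡ (leaf-≪ (n<1+n _)) (≪-trans F≤ (leaf-≪ (n<1+n _)))))
  where N⊆ = Extends-⊆ᴸ N⊇F

InG-labels : ∀ {G} → InG G → leaf 0 ≪ G × G ≪ leaf (suc (size G))
InG-labels base                        = labels-extend {F = []} (extends ↭-refl) (≪-[]ʳ , ≪-[]ˡ)
InG-labels (minus {F} g)               = labels-extend (extends-minus _ F) (InG-labels g)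
InG-labels (plusEnd {F} g)             = labels-extend (extends-plusEnd F _) (InG-labels g)
InG-labels (plusAt {P} {a} {cs} {S} g) = labels-extend (extends-plusAt P a cs S _) (InG-labels g)

InG⇒InGᵘ : ∀ {G} → InG G → InGᵘ G
InG⇒InGᵘ base        = minus empty ≪-[]ˡ
InG⇒InGᵘ (minus g)   = minus (InG⇒InGᵘ g) (proj₂ (InG-labels g))
InG⇒InGᵘ (plusEnd g) = plusEnd (InG⇒InGᵘ g) (proj₂ (InG-labels g))
InG⇒InGᵘ (plusAt g)  = plusAt (InG⇒InGᵘ g) (proj₂ (InG-labels g))

prod⇒InBᵘ : ∀ {Gs} → All InG Gs → InBᵘ (prod Gs) × leaf 0 ≪ prod Gs
prod⇒InBᵘ []               = [] , ≪-[]ʳ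
prod⇒InBᵘ {G ∷ _} (g ∷ gs) with prod⇒InBᵘ gs | InG-labels g
... | h , H>0 | G>0 , G≤ =
  block (InG⇒InGᵘ g) (≪-shift G≤ H>0) (InBᵘ-relabel (+-monoʳ-< (size G)) h) ,
  ≪-++ʳ G>0 (≪-shift (leaf-≪ (s≤s z≤n)) H>0)

Lea-InB : ∀ v F → InB F → InB (Lea v F)
Lea-InB v F (Gs , gs , refl) = InBᵘ⇒InB (InBᵘ-lea v (proj₁ (prod⇒InBᵘ gs)))

Roo-InB : ∀ v F → InB F → InB (Roo v F)
Roo-InB v F (Gs , gs , refl) = InBᵘ⇒InB (InBᵘ-roo v (proj₁ (prod⇒InBᵘ gs)))

proposition1p7 : ∀ {c ℓ} (K : Field c ℓ) (x : ℋ K) → InBᴴ K x → InB⊗B K (Δ K x)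
proposition1p7 K x x∈B = Δ K x , Δ-terms x x∈B , λ _ _ → Field.refl K
  where
  Δ-terms : ∀ x → InBᴴ K x → All (λ p → InB (proj₁ (proj₂ p)) × InB (proj₂ (proj₂ p))) (Δ K x)
  Δ-terms []            []           = []
  Δ-terms ((k , F) ∷ x) (F∈B ∷ x∈B) =
    ++⁺ (map⁺ (map⁺ (All.universal (λ v → Lea-InB v F F∈B , Roo-InB v F F∈B) (cuts F)))) (Δ-terms x x∈B)
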